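{- Let $G$ be a graph and $s\ge 0$. Every minimal $Q_s$-generator $(U,C)$ in $G$ has the following form: $U=\{v_0,\dots,v_{s-1}\}$ consists of $s$ distinct vertices, and there are positive integers $k_{0,0}<k_{0,1},\ k_{1,0}<k_{1,1},\ \dots,\ k_{s-1,0}<k_{s-1,1}$ such that $C=\{c_0,\dots,c_{2^s-1}\}$ with $c_i(v_j)=k_{j,\ \lfloor i/2^j\rfloor \bmod 2}$ for all $0\le i\le 2^s-1$ and $0\le j\le s-1$.
   Context: Graphs are finite and simple. $Q_s$ is the $s$-dimensional hypercube, the Cartesian product of $s$ copies of the one-edge graph $P_2$ ($Q_0$ is the one-vertex graph). For a graph $H$, an $H$-generator in $G$ is a pair $(U,C)$ with $U\subseteq V(G)$ and $C$ a set of $|V(H)|$ functions $U\to\mathbb{N}$ such that (i) each $c\in C$ is a proper coloring of $G[U]$, and (ii) the graph on vertex set $C$ in which two functions are adjacent iff they differ at exactly one vertex of $U$ is isomorphic to $H$. It is minimal if additionally (iii) each $v\in U$ takes at least two different values among the functions in $C$, and (iv) whenever $\kappa$ is a value taken by some $c\in C$, every positive integer less than $\kappa$ is taken by some function in $C$. (For $U=\emptyset$, $C$ consists of the empty function.) -}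

module Defs where

open import Data.Nat using (ℕ; zero; suc; _*_; _^_; _≤_; _<_; NonZero)
open import Data.Nat.Properties using (m^n≢0)
open import Data.Nat.DivMod using (_/_; _mod_)
open import Data.Fin using (Fin; toℕ; remQuot)
open import Data.Fin.Subset using (Subset; _∈_)
open import Data.Product using (Σ; ∃; ∃-syntax; _×_; _,_)
open import Data.Sum using (_⊎_)
open import Data.Empty using (⊥)
open import Relation.Nullary using (¬_)
open import Relation.Binary.PropositionalEquality using (_≡_; _≢_)

record Graph : Set₁ where
  field
    n   : ℕ
    Adj : Fin n → Fin n → Set
open Graph public

IsSimple : Graph → Set
IsSimple G = (∀ u v → Adj G u v → Adj G v u) × (∀ v → ¬ Adj G v v)

_□_ : Graph → Graph → Graph
G □ H = record
  { n   = n G * n H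
  ; Adj = λ x y → adj (remQuot (n H) x) (remQuot (n H) y) }
  where
    adj : Fin (n G) × Fin (n H) → Fin (n G) × Fin (n H) → Set
    adj (a , b) (a' , b') = (a ≡ a' × Adj H b b') ⊎ (Adj G a a' × b ≡ b')

P₂ : Graph
P₂ = record { n = 2 ; Adj = λ a b → a ≢ b }

K₁ : Graph
K₁ = record { n = 1 ; Adj = λ _ _ → ⊥ }

Q : ℕ → Graph
Q zero    = K₁
Q (suc s) = Q s □ P₂

Fun : {n : ℕ} → Subset n → Set
Fun {n} U = (v : Fin n) → v ∈ U → ℕ

_≈U_ : {n : ℕ} {U : Subset n} → Fun U → Fun U → Set
_≈U_ {n} {U} c c' = (v : Fin n) (p : v ∈ U) → c v p ≡ c' v p

DifferAtOne : {n : ℕ} {U : Subset n} → Fun U → Fun U → Set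
DifferAtOne {n} {U} c c' =
  Σ (Fin n) λ v → Σ (v ∈ U) λ p → (c v p ≢ c' v p) ×
    ((w : Fin n) (q : w ∈ U) → c w q ≢ c' w q → w ≡ v)

ProperOn : (G : Graph) (U : Subset (n G)) → Fun U → Set
ProperOn G U c = (u v : Fin (n G)) (p : u ∈ U) (q : v ∈ U) → Adj G u v → c u p ≢ c v q

-- An H-generator (U , C) in G. The set C of |V(H)| functions is given as an
-- injective family C : Fin (n H) → Fun U. Values lie in ℕ = {1,2,...} (positive).
record IsGenerator (H G : Graph) (U : Subset (n G)) (C : Fin (n H) → Fun U) : Set where
  field
    positive  : ∀ a v (p : v ∈ U) → 1 ≤ C a v p
    distinct  : ∀ a b → C a ≈U C b → a ≡ b
    proper    : ∀ a → ProperOn G U (C a)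
    -- (ii): the graph on C (adjacency = differ at exactly one vertex of U) is isomorphic to H
    iso       : Fin (n H) → Fin (n H)
    iso⁻¹     : Fin (n H) → Fin (n H)
    iso-inv₁  : ∀ a → iso⁻¹ (iso a) ≡ a
    iso-inv₂  : ∀ x → iso (iso⁻¹ x) ≡ x
    iso-adj   : ∀ a b → (DifferAtOne (C a) (C b) → Adj H (iso a) (iso b))
                      × (Adj H (iso a) (iso b) → DifferAtOne (C a) (C b))

record IsMinimalGenerator (H G : Graph) (U : Subset (n G)) (C : Fin (n H) → Fun U) : Set where
  field
    generator : IsGenerator H G U C
    varies    : ∀ v (p : v ∈ U) → Σ (Fin (n H)) λ a → Σ (Fin (n H)) λ b → C a v p ≢ C b v p
    downward  : ∀ a v (p : v ∈ U) (κ : ℕ) → 1 ≤ κ → κ < C a v p →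
                Σ (Fin (n H)) λ b → Σ (Fin (n G)) λ w → Σ (w ∈ U) λ q → C b w q ≡ κ

bit : ℕ → ℕ → Fin 2
bit i j = (i / (2 ^ j)) {{m^n≢0 2 j}} mod 2

module Submission where

-- Index the functions of C by binary words x via the hypercube isomorphism, writing D x.
-- The edge from the all-zero word along coordinate d changes D at a single vertex axis d.
-- In every 4-cycle of the cube the diagonal colourings are neither equal nor adjacent,
-- which forces opposite edges to change the same vertex between the same two values; so,
-- spreading from the all-zero word, every edge along d changes exactly axis d, D x takes at
-- axis d one of two fixed values according to x_d, and D x is constant off the axes.
-- Condition (iii) then makes the axes exhaust U, and sorting the two values of each axis
-- gives the numbers k.

open import Defs
open import Data.Nat using (ℕ; zero; suc; _+_; _*_; _^_; _≤_; _<_)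
open import Data.Nat.Properties as ℕ using (+-comm; *-comm; +-identityʳ; m^n≢0; _<?_; ≤∧≢⇒<; ≮⇒≥)
open import Data.Nat.DivMod using (_/_; _%_; _mod_; n/1≡n; [m+kn]%n≡m%n; m<n⇒m%n≡m; m/n/o≡m/[n*o]; +-distrib-/-∣ˡ; m*n/n≡m; m<n⇒m/n≡0)
open import Data.Nat.Divisibility using (divides)
open import Data.Fin using (Fin; zero; suc; toℕ; combine; remQuot; opposite; cast)
open import Data.Fin.Properties using (_≟_; any?; toℕ-injective; toℕ-fromℕ<; toℕ<n; toℕ-combine; toℕ-cast; remQuot-combine; combine-remQuot; opposite-involutive)
open import Data.Fin.Subset using (Subset; _∈_)
open import Data.Vec using (Vec; []; _∷_; lookup; replicate; tabulate; updateAt)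
open import Data.Vec.Properties using (updateAt-updateAt; updateAt-id-local; updateAt-commutes; lookup∘updateAt; lookup∘updateAt′; lookup-replicate; lookup∘tabulate)
open import Data.Vec.Properties.WithK using ([]=-irrelevant)
open import Data.Product using (Σ; ∃-syntax; _×_; _,_; proj₁; proj₂; uncurry)
open import Data.Sum using (_⊎_; inj₁; inj₂)
open import Function using (_∘_; id)
open import Relation.Nullary using (¬_; yes; no; contradiction)
open import Relation.Binary.PropositionalEquality using (_≡_; _≢_; refl; sym; trans; cong; cong₂; subst; subst₂; ≢-sym; module ≡-Reasoning)
open ≡-Reasoning

private variable s : ℕ

Word : ℕ → Set
Word s = Vec (Fin 2) s

toggle : Fin s → Word s → Word s
toggle d x = updateAt x d opposite

opposite-≢ : (b : Fin 2) → opposite b ≢ b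
opposite-≢ zero       ()
opposite-≢ (suc zero) ()

≢⇒≡opposite : {b b′ : Fin 2} → b ≢ b′ → b′ ≡ opposite b
≢⇒≡opposite {zero}     {zero}     b≢b′ = contradiction refl b≢b′
≢⇒≡opposite {zero}     {suc zero} _    = refl
≢⇒≡opposite {suc zero} {zero}     _    = refl
≢⇒≡opposite {suc zero} {suc zero} b≢b′ = contradiction refl b≢b′

toggle-involutive : ∀ d (x : Word s) → toggle d (toggle d x) ≡ x
toggle-involutive d x =
  trans (updateAt-updateAt d x) (updateAt-id-local d x (opposite-involutive (lookup x d)))

toggle-comm : ∀ d e (x : Word s) → toggle d (toggle e x) ≡ toggle e (toggle d x)
toggle-comm d e x with d ≟ e
... | yes refl = refl
... | no  d≢e  = updateAt-commutes d e d≢e x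

lookup-toggle-≢⇒≡ : ∀ d i (x : Word s) → lookup (toggle d x) i ≢ lookup x i → i ≡ d
lookup-toggle-≢⇒≡ d i x changed with i ≟ d
... | yes i≡d = i≡d
... | no  i≢d = contradiction (lookup∘updateAt′ i d i≢d x) changed

toggle-injectiveˡ : ∀ {d e} (x : Word s) → toggle d x ≡ toggle e x → d ≡ e
toggle-injectiveˡ {d = d} {e} x eq = lookup-toggle-≢⇒≡ e d x λ unchanged →
  opposite-≢ (lookup x d) (begin
    opposite (lookup x d)  ≡⟨ lookup∘updateAt d x ⟨
    lookup (toggle d x) d  ≡⟨ cong (λ y → lookup y d) eq ⟩
    lookup (toggle e x) d  ≡⟨ unchanged ⟩
    lookup x d             ∎)

lookup-toggle²-≢ : ∀ {d e} (x : Word s) → d ≢ e → lookup (toggle d (toggle e x)) d ≢ lookup x d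
lookup-toggle²-≢ {d = d} {e} x d≢e unchanged = opposite-≢ (lookup x d) (begin
  opposite (lookup x d)                ≡⟨ cong opposite (lookup∘updateAt′ d e d≢e x) ⟨
  opposite (lookup (toggle e x) d)     ≡⟨ lookup∘updateAt d (toggle e x) ⟨
  lookup (toggle d (toggle e x)) d     ≡⟨ unchanged ⟩
  lookup x d                           ∎)

toggle²≢id : ∀ {d e} (x : Word s) → d ≢ e → toggle d (toggle e x) ≢ x
toggle²≢id {d = d} x d≢e eq = lookup-toggle²-≢ x d≢e (cong (λ y → lookup y d) eq)

toggle²≢toggle : ∀ {d e k} (x : Word s) → d ≢ e → toggle d (toggle e x) ≢ toggle k x
toggle²≢toggle {d = d} {e} {k} x d≢e eq = d≢e (trans d≡k (sym e≡k))
  where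
  d≡k : d ≡ k
  d≡k = lookup-toggle-≢⇒≡ k d x λ unchanged →
    lookup-toggle²-≢ x d≢e (trans (cong (λ y → lookup y d) eq) unchanged)
  e≡k : e ≡ k
  e≡k = lookup-toggle-≢⇒≡ k e x λ unchanged →
    lookup-toggle²-≢ x (≢-sym d≢e)
      (trans (cong (λ y → lookup y e) (trans (toggle-comm e d x) eq)) unchanged)

toggle-induction : (P : Word s → Set) → P (replicate s zero) →
                   (∀ x d → P x → P (toggle d x)) → ∀ x → P x
toggle-induction {zero}  P base step []      = base
toggle-induction {suc s} P base step (b ∷ x) = by-head b
  where
  tail-induction : ∀ x → P (zero ∷ x)
  tail-induction = toggle-induction (P ∘ (zero ∷_)) base (λ x d → step (zero ∷ x) (suc d))
  by-head : ∀ b → P (b ∷ x)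
  by-head zero       = tail-induction x
  by-head (suc zero) = step (zero ∷ x) zero (tail-induction x)

vertex : Word s → Fin (n (Q s))
vertex []      = zero
vertex (b ∷ x) = combine (vertex x) b

word : Fin (n (Q s)) → Word s
word {zero}  _ = []
word {suc s} a = uncurry (λ a′ b → b ∷ word a′) (remQuot {n (Q s)} 2 a)

word-vertex : (x : Word s) → word (vertex x) ≡ x
word-vertex []              = refl
word-vertex {suc s} (b ∷ x) = begin
  word (combine (vertex x) b)  ≡⟨ cong (uncurry (λ a′ b → b ∷ word a′)) (remQuot-combine {n (Q s)} {2} (vertex x) b) ⟩
  b ∷ word (vertex x)          ≡⟨ cong (b ∷_) (word-vertex x) ⟩
  b ∷ x                        ∎

vertex-word : (a : Fin (n (Q s))) → vertex (word {s} a) ≡ a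
vertex-word {zero}  zero = refl
vertex-word {suc s} a    = begin
  combine (vertex (word {s} (proj₁ r))) (proj₂ r)  ≡⟨ cong (λ a′ → combine a′ (proj₂ r)) (vertex-word {s} (proj₁ r)) ⟩
  combine (proj₁ r) (proj₂ r)                      ≡⟨ combine-remQuot {n (Q s)} 2 a ⟩
  a                                                ∎
  where r = remQuot {n (Q s)} 2 a

vertex-injective : {x y : Word s} → vertex x ≡ vertex y → x ≡ y
vertex-injective {x = x} {y} eq = trans (sym (word-vertex x)) (trans (cong word eq) (word-vertex y))

-- Definitionally the local adjacency of Defs._□_ for Q s □ P₂, on remQuot-pairs.
CubeProductAdj : ∀ s → Fin (n (Q s)) × Fin 2 → Fin (n (Q s)) × Fin 2 → Set
CubeProductAdj s (a , b) (a′ , b′) = (a ≡ a′ × b ≢ b′) ⊎ (Adj (Q s) a a′ × b ≡ b′)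

Q-adj-combine⁻ : ∀ {a a′ : Fin (n (Q s))} {b b′} → Adj (Q (suc s)) (combine a b) (combine a′ b′) →
                 CubeProductAdj s (a , b) (a′ , b′)
Q-adj-combine⁻ {s} {a} {a′} {b} {b′} =
  subst₂ (CubeProductAdj s) (remQuot-combine {n (Q s)} {2} a b) (remQuot-combine {n (Q s)} {2} a′ b′)

Q-adj-combine⁺ : ∀ {a a′ : Fin (n (Q s))} {b b′} → CubeProductAdj s (a , b) (a′ , b′) →
                 Adj (Q (suc s)) (combine a b) (combine a′ b′)
Q-adj-combine⁺ {s} {a} {a′} {b} {b′} =
  subst₂ (CubeProductAdj s) (sym (remQuot-combine {n (Q s)} {2} a b)) (sym (remQuot-combine {n (Q s)} {2} a′ b′))

vertex-adj-toggle : ∀ (x : Word s) d → Adj (Q s) (vertex x) (vertex (toggle d x))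
vertex-adj-toggle {suc s} (b ∷ x) zero    = Q-adj-combine⁺ {s} (inj₁ (refl , ≢-sym (opposite-≢ b)))
vertex-adj-toggle {suc s} (b ∷ x) (suc d) = Q-adj-combine⁺ {s} (inj₂ (vertex-adj-toggle x d , refl))

vertex-adj⇒toggle : ∀ (x y : Word s) → Adj (Q s) (vertex x) (vertex y) → ∃[ d ] y ≡ toggle d x
vertex-adj⇒toggle {suc s} (b ∷ x) (b′ ∷ y) adj with Q-adj-combine⁻ {s} {vertex x} {vertex y} {b} {b′} adj
... | inj₁ (x≡y , b≢b′) = zero , cong₂ _∷_ (≢⇒≡opposite b≢b′) (sym (vertex-injective x≡y))
... | inj₂ (adj′ , refl) with vertex-adj⇒toggle x y adj′
...   | d , refl = suc d , refl

n[Q]≡2^ : ∀ s → n (Q s) ≡ 2 ^ s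
n[Q]≡2^ zero    = refl
n[Q]≡2^ (suc s) = trans (cong (_* 2) (n[Q]≡2^ s)) (*-comm (2 ^ s) 2)

bit-zero : ∀ m (b : Fin 2) → bit (2 * m + toℕ b) 0 ≡ b
bit-zero m b = toℕ-injective (begin
  toℕ (bit (2 * m + toℕ b) 0)  ≡⟨ toℕ-fromℕ< _ ⟩
  (2 * m + toℕ b) / 1 % 2      ≡⟨ cong (_% 2) (n/1≡n (2 * m + toℕ b)) ⟩
  (2 * m + toℕ b) % 2          ≡⟨ cong (_% 2) (+-comm (2 * m) (toℕ b)) ⟩
  (toℕ b + 2 * m) % 2          ≡⟨ cong (λ t → (toℕ b + t) % 2) (*-comm 2 m) ⟩
  (toℕ b + m * 2) % 2          ≡⟨ [m+kn]%n≡m%n (toℕ b) m 2 ⟩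
  toℕ b % 2                    ≡⟨ m<n⇒m%n≡m (toℕ<n b) ⟩
  toℕ b                        ∎)

bit-suc : ∀ m (b : Fin 2) j → bit (2 * m + toℕ b) (suc j) ≡ bit m j
bit-suc m b j = cong (_mod 2) (begin
  (2 * m + toℕ b) / 2 ^ suc j  ≡⟨ m/n/o≡m/[n*o] (2 * m + toℕ b) 2 (2 ^ j) ⟨
  (2 * m + toℕ b) / 2 / 2 ^ j  ≡⟨ cong (_/ 2 ^ j) half ⟩
  m / 2 ^ j                    ∎)
  where
  instance
    2^j≢0   = m^n≢0 2 j
    2^1+j≢0 = m^n≢0 2 (suc j)
  half : (2 * m + toℕ b) / 2 ≡ m
  half = begin
    (2 * m + toℕ b) / 2    ≡⟨ +-distrib-/-∣ˡ (toℕ b) (divides m (*-comm 2 m)) ⟩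
    2 * m / 2 + toℕ b / 2  ≡⟨ cong₂ _+_ (trans (cong (_/ 2) (*-comm 2 m)) (m*n/n≡m m 2)) (m<n⇒m/n≡0 (toℕ<n b)) ⟩
    m + 0                  ≡⟨ +-identityʳ m ⟩
    m                      ∎

bit-vertex : ∀ (x : Word s) j → bit (toℕ (vertex x)) (toℕ j) ≡ lookup x j
bit-vertex (b ∷ x) j =
  trans (cong (λ m → bit m (toℕ j)) (toℕ-combine (vertex x) b)) (bit-at j)
  where
  bit-at : ∀ j → bit (2 * toℕ (vertex x) + toℕ b) (toℕ j) ≡ lookup (b ∷ x) j
  bit-at zero    = bit-zero (toℕ (vertex x)) b
  bit-at (suc j) = trans (bit-suc (toℕ (vertex x)) b (toℕ j)) (bit-vertex x j)

orient : (Fin 2 → ℕ) → Fin 2 → Fin 2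
orient f with f zero <? f (suc zero)
... | yes _ = id
... | no  _ = opposite

orient-involutive : ∀ (f : Fin 2 → ℕ) b → orient f (orient f b) ≡ b
orient-involutive f b with f zero <? f (suc zero)
... | yes _ = refl
... | no  _ = opposite-involutive b

orient-ascending : (f : Fin 2 → ℕ) → f zero ≢ f (suc zero) → f (orient f zero) < f (orient f (suc zero))
orient-ascending f f₀≢f₁ with f zero <? f (suc zero)
... | yes f₀<f₁ = f₀<f₁
... | no  f₀≮f₁ = ≤∧≢⇒< (≮⇒≥ f₀≮f₁) (≢-sym f₀≢f₁)

module _ {N : ℕ} {U : Subset N} where

  Fun-irrelevant : (c : Fun U) {v : Fin N} (p q : v ∈ U) → c v p ≡ c v q
  Fun-irrelevant c p q = cong (c _) ([]=-irrelevant p q)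

  DiffersOnlyAt : Fun U → Fun U → Fin N → Set
  DiffersOnlyAt c c′ w = ∀ v (p : v ∈ U) → c v p ≢ c′ v p → v ≡ w

  agree-outside : ∀ {c c′ w v} → DiffersOnlyAt c c′ w → (p : v ∈ U) → v ≢ w → c v p ≡ c′ v p
  agree-outside {c} {c′} only p v≢w with c _ p ℕ.≟ c′ _ p
  ... | yes c≡c′ = c≡c′
  ... | no  c≢c′ = contradiction (only _ p c≢c′) v≢w

  differsOnlyAt-sym : ∀ {c c′ w} → DiffersOnlyAt c c′ w → DiffersOnlyAt c′ c w
  differsOnlyAt-sym only v p c′≢c = only v p (≢-sym c′≢c)

  differsOnlyAt-trans : ∀ {c₀ c₁ c₂ w} →
                        DiffersOnlyAt c₀ c₁ w → DiffersOnlyAt c₁ c₂ w → DiffersOnlyAt c₀ c₂ w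
  differsOnlyAt-trans {w = w} only₀₁ only₁₂ v p c₀≢c₂ with v ≟ w
  ... | yes v≡w = v≡w
  ... | no  v≢w =
    contradiction (trans (agree-outside only₀₁ p v≢w) (agree-outside only₁₂ p v≢w)) c₀≢c₂

  differsOnlyAt⇒≈U⊎DifferAtOne : ∀ {c c′ w} → w ∈ U → DiffersOnlyAt c c′ w →
                                 c ≈U c′ ⊎ DifferAtOne c c′
  differsOnlyAt⇒≈U⊎DifferAtOne {c} {c′} {w} p only with c w p ℕ.≟ c′ w p
  ... | no  c≢c′ = inj₂ (w , p , c≢c′ , only)
  ... | yes c≡c′ = inj₁ c≈c′
    where
    c≈c′ : c ≈U c′
    c≈c′ v q with v ≟ w
    ... | yes refl = trans (Fun-irrelevant c q p) (trans c≡c′ (Fun-irrelevant c′ p q))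
    ... | no  v≢w  = agree-outside only q v≢w

  -- Going round through c₁ and through c₃, c₀ and c₂ differ exactly at w and w₂; if the
  -- edge c₀c₃ changed w then c₁ = c₃.
  square : ∀ {c₀ c₁ c₂ c₃ w} (p : w ∈ U) → c₀ w p ≢ c₁ w p → DiffersOnlyAt c₀ c₁ w →
           DifferAtOne c₁ c₂ → DifferAtOne c₀ c₃ → DifferAtOne c₃ c₂ →
           ¬ (c₀ ≈U c₂ ⊎ DifferAtOne c₀ c₂) → ¬ c₁ ≈U c₃ →
           DiffersOnlyAt c₃ c₂ w × c₃ w p ≡ c₀ w p × c₂ w p ≡ c₁ w p
  square {c₀} {c₁} {c₂} {c₃} {w} p c₀≢c₁ only₀₁
         (w₂ , p₂ , c₁≢c₂ , only₁₂) (w₄ , _ , _ , only₀₃) (w₃ , _ , _ , only₃₂) far₀₂ c₁≉c₃ =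
    subst (DiffersOnlyAt c₃ c₂) (sym w≡w₃) only₃₂ ,
    sym (agree-outside only₀₃ p w≢w₄) ,
    sym (agree-outside only₁₂ p w≢w₂)
    where
    w≢w₂ : w ≢ w₂
    w≢w₂ refl = far₀₂ (differsOnlyAt⇒≈U⊎DifferAtOne p (differsOnlyAt-trans only₀₁ only₁₂))
    w≡w₃ : w ≡ w₃
    w≡w₃ with w ≟ w₃ | w ≟ w₄
    ... | yes w≡w₃ | _        = w≡w₃
    ... | no  w≢w₃ | no  w≢w₄ = contradiction
      (trans (agree-outside only₀₃ p w≢w₄) (trans (agree-outside only₃₂ p w≢w₃)
        (sym (agree-outside only₁₂ p w≢w₂))))
      c₀≢c₁
    ... | no  w≢w₃ | yes refl = contradiction c₁≈c₃ c₁≉c₃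
      where
      c₁≈c₃ : c₁ ≈U c₃
      c₁≈c₃ v q with v ≟ w
      ... | yes refl = trans (agree-outside only₁₂ q w≢w₂) (sym (agree-outside only₃₂ q w≢w₃))
      ... | no  v≢w  = trans (sym (agree-outside only₀₁ q v≢w)) (agree-outside only₀₃ q v≢w)
    w≢w₄ : w ≢ w₄
    w≢w₄ refl = c₁≢c₂ (begin
      c₁ w₂ p₂  ≡⟨ agree-outside only₀₁ p₂ (≢-sym w≢w₂) ⟨
      c₀ w₂ p₂  ≡⟨ agree-outside only₀₃ p₂ (≢-sym w≢w₂) ⟩
      c₃ w₂ p₂  ≡⟨ agree-outside only₃₂ p₂ (λ w₂≡w₃ → w≢w₂ (trans w≡w₃ (sym w₂≡w₃))) ⟩
      c₂ w₂ p₂  ∎)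

module CubeEmbedding {s N : ℕ} {U : Subset N} (D : Word s → Fun U)
  (D-injective : ∀ {x y} → D x ≈U D y → x ≡ y)
  (D-toggle : ∀ x d → DifferAtOne (D x) (D (toggle d x)))
  (D-adjacent : ∀ {x y} → DifferAtOne (D x) (D y) → ∃[ d ] y ≡ toggle d x)
  where

  origin : Word s
  origin = replicate s zero

  axis : Fin s → Fin N
  axis d = proj₁ (D-toggle origin d)

  axis∈U : ∀ d → axis d ∈ U
  axis∈U d = proj₁ (proj₂ (D-toggle origin d))

  _at_ : Word s → Fin s → ℕ
  x at d = D x (axis d) (axis∈U d)

  colour : Fin s → Fin 2 → ℕ
  colour d zero       = origin at d
  colour d (suc zero) = toggle d origin at d

  colour-distinct : ∀ d b → colour d b ≢ colour d (opposite b)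
  colour-distinct d zero       = proj₁ (proj₂ (proj₂ (D-toggle origin d)))
  colour-distinct d (suc zero) = ≢-sym (colour-distinct d zero)

  toggle²-far : ∀ x {d e} → d ≢ e →
                ¬ (D x ≈U D (toggle d (toggle e x)) ⊎ DifferAtOne (D x) (D (toggle d (toggle e x))))
  toggle²-far x d≢e (inj₁ D≈D)  = toggle²≢id x d≢e (sym (D-injective D≈D))
  toggle²-far x d≢e (inj₂ edge) = toggle²≢toggle x d≢e (proj₂ (D-adjacent edge))

  Parallel : Word s → Fin s → Set
  Parallel x d = DiffersOnlyAt (D x) (D (toggle d x)) (axis d)
               × x at d ≡ colour d (lookup x d)
               × toggle d x at d ≡ colour d (opposite (lookup x d))

  parallel-origin : ∀ d → Parallel origin d
  parallel-origin d = proj₂ (proj₂ (proj₂ (D-toggle origin d))) ,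
                      cong (colour d) (sym origin-d≡0) , cong (colour d ∘ opposite) (sym origin-d≡0)
    where
    origin-d≡0 : lookup origin d ≡ zero
    origin-d≡0 = lookup-replicate d zero

  parallel-toggle-same : ∀ x d → Parallel x d → Parallel (toggle d x) d
  parallel-toggle-same x d (only , here , there)
    rewrite toggle-involutive d x | lookup∘updateAt d {opposite} x | opposite-involutive (lookup x d)
    = differsOnlyAt-sym only , there , here

  parallel-toggle-other : ∀ x {d e} → d ≢ e → Parallel x d → Parallel (toggle e x) d
  parallel-toggle-other x {d} {e} d≢e (only , here , there)
    with square (axis∈U d)
                (λ eq → colour-distinct d (lookup x d) (trans (sym here) (trans eq there))) only
                (subst (DifferAtOne (D (toggle d x)) ∘ D) (toggle-comm e d x) (D-toggle (toggle d x) e))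
                (D-toggle x e) (D-toggle (toggle e x) d)
                (toggle²-far x d≢e) (d≢e ∘ toggle-injectiveˡ x ∘ D-injective)
  ... | only′ , here′ , there′ =
    only′ , trans here′ (trans here (cong (colour d) unchanged)) ,
    trans there′ (trans there (cong (colour d ∘ opposite) unchanged))
    where
    unchanged : lookup x d ≡ lookup (toggle e x) d
    unchanged = sym (lookup∘updateAt′ d e d≢e x)

  parallel : ∀ x d → Parallel x d
  parallel = toggle-induction (λ x → ∀ d → Parallel x d) parallel-origin step
    where
    step : ∀ x e → (∀ d → Parallel x d) → ∀ d → Parallel (toggle e x) d
    step x e par d with d ≟ e
    ... | yes refl = parallel-toggle-same x d (par d)
    ... | no  d≢e  = parallel-toggle-other x d≢e (par d)

  at-axis : ∀ x d → x at d ≡ colour d (lookup x d)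
  at-axis x d = proj₁ (proj₂ (parallel x d))

  off-axes : ∀ {w} (p : w ∈ U) → (∀ d → axis d ≢ w) → ∀ x → D x w p ≡ D origin w p
  off-axes {w} p off = toggle-induction (λ x → D x w p ≡ D origin w p) refl λ x d D≡ →
    trans (sym (agree-outside (proj₁ (parallel x d)) p (≢-sym (off d)))) D≡

  axis-injective : ∀ {d e} → axis d ≡ axis e → d ≡ e
  axis-injective {d} {e} axis-d≡axis-e with d ≟ e
  ... | yes d≡e = d≡e
  ... | no  d≢e = contradiction (differsOnlyAt⇒≈U⊎DifferAtOne (axis∈U d)
          (differsOnlyAt-trans (proj₁ (parallel origin d))
            (subst (DiffersOnlyAt _ _) (sym axis-d≡axis-e) (proj₁ (parallel (toggle d origin) e)))))
          (toggle²-far origin (≢-sym d≢e))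

  varying⇒axis : ∀ {w} (p : w ∈ U) x y → D x w p ≢ D y w p → ∃[ d ] axis d ≡ w
  varying⇒axis {w} p x y Dx≢Dy with any? (λ d → axis d ≟ w)
  ... | yes on  = on
  ... | no  off = contradiction (trans (off-axes p off′ x) (sym (off-axes p off′ y))) Dx≢Dy
    where
    off′ : ∀ d → axis d ≢ w
    off′ d axis-d≡w = off (d , axis-d≡w)

  level : Fin s → Fin 2 → ℕ
  level d = colour d ∘ orient (colour d)

  level-ascending : ∀ d → level d zero < level d (suc zero)
  level-ascending d = orient-ascending (colour d) (colour-distinct d zero)

  reorient : Word s → Word s
  reorient x = tabulate λ d → orient (colour d) (lookup x d)

  at-axis-level : ∀ x d → x at d ≡ level d (lookup (reorient x) d)
  at-axis-level x d = begin
    x at d                                    ≡⟨ at-axis x d ⟩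
    colour d (lookup x d)                     ≡⟨ cong (colour d) (orient-involutive (colour d) (lookup x d)) ⟨
    level d (orient (colour d) (lookup x d))  ≡⟨ cong (level d) (lookup∘tabulate _ d) ⟨
    level d (lookup (reorient x) d)           ∎

  reorient-at-axis : ∀ y d → reorient y at d ≡ level d (lookup y d)
  reorient-at-axis y d = trans (at-axis (reorient y) d) (cong (colour d) (lookup∘tabulate _ d))

module MinimalCubeGenerator {G : Graph} {s : ℕ} {U : Subset (n G)} {C : Fin (n (Q s)) → Fun U}
                            (M : IsMinimalGenerator (Q s) G U C) where
  open IsMinimalGenerator M
  open IsGenerator generator

  D : Word s → Fun U
  D x = C (iso⁻¹ (vertex x))

  C≡D : ∀ a → C a ≡ D (word {s} (iso a))
  C≡D a = cong C (trans (sym (iso-inv₁ a)) (cong iso⁻¹ (sym (vertex-word {s} (iso a)))))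

  D-injective : ∀ {x y} → D x ≈U D y → x ≡ y
  D-injective {x} {y} Dx≈Dy = vertex-injective (begin
    vertex x                ≡⟨ iso-inv₂ (vertex x) ⟨
    iso (iso⁻¹ (vertex x))  ≡⟨ cong iso (distinct _ _ Dx≈Dy) ⟩
    iso (iso⁻¹ (vertex y))  ≡⟨ iso-inv₂ (vertex y) ⟩
    vertex y                ∎)

  D-toggle : ∀ x d → DifferAtOne (D x) (D (toggle d x))
  D-toggle x d = proj₂ (iso-adj _ _)
    (subst₂ (Adj (Q s)) (sym (iso-inv₂ _)) (sym (iso-inv₂ _)) (vertex-adj-toggle x d))

  D-adjacent : ∀ {x y} → DifferAtOne (D x) (D y) → ∃[ d ] y ≡ toggle d x
  D-adjacent {x} {y} edge = vertex-adj⇒toggle x y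
    (subst₂ (Adj (Q s)) (iso-inv₂ _) (iso-inv₂ _) (proj₁ (iso-adj _ _) edge))

  open CubeEmbedding D D-injective D-toggle D-adjacent public

  axes-cover : ∀ w → w ∈ U → ∃[ d ] axis d ≡ w
  axes-cover w p = varying⇒axis p (word (iso a)) (word (iso b))
    (subst₂ (λ c c′ → c w p ≢ c′ w p) (C≡D a) (C≡D b) Ca≢Cb)
    where
    a = proj₁ (varies w p)
    b = proj₁ (proj₂ (varies w p))
    Ca≢Cb = proj₂ (proj₂ (varies w p))

  colour-positive : ∀ d b → 1 ≤ colour d b
  colour-positive d zero       = positive _ _ _
  colour-positive d (suc zero) = positive _ _ _

  level-positive : ∀ d b → 1 ≤ level d b
  level-positive d b = colour-positive d (orient (colour d) b)

  index : Word s → Fin (2 ^ s)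
  index x = cast (n[Q]≡2^ s) (vertex x)

  bit-index : ∀ x d → bit (toℕ (index x)) (toℕ d) ≡ lookup x d
  bit-index x d =
    trans (cong (λ m → bit m (toℕ d)) (toℕ-cast (n[Q]≡2^ s) (vertex x))) (bit-vertex x d)

  C-index : ∀ a → Σ (Fin (2 ^ s)) λ i →
            ∀ d (p : axis d ∈ U) → C a (axis d) p ≡ level d (bit (toℕ i) (toℕ d))
  C-index a = index (reorient x) , λ d p → begin
    C a (axis d) p                                    ≡⟨ cong (λ c → c (axis d) p) (C≡D a) ⟩
    D x (axis d) p                                    ≡⟨ Fun-irrelevant (D x) p (axis∈U d) ⟩
    x at d                                            ≡⟨ at-axis-level x d ⟩
    level d (lookup (reorient x) d)                   ≡⟨ cong (level d) (bit-index (reorient x) d) ⟨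
    level d (bit (toℕ (index (reorient x))) (toℕ d))  ∎
    where x = word (iso a)

  index-C : ∀ (i : Fin (2 ^ s)) → Σ (Fin (n (Q s))) λ a →
            ∀ d (p : axis d ∈ U) → C a (axis d) p ≡ level d (bit (toℕ i) (toℕ d))
  index-C i = iso⁻¹ (vertex (reorient y)) , λ d p → begin
    D (reorient y) (axis d) p      ≡⟨ Fun-irrelevant (D (reorient y)) p (axis∈U d) ⟩
    reorient y at d                ≡⟨ reorient-at-axis y d ⟩
    level d (lookup y d)           ≡⟨ cong (level d) (lookup∘tabulate _ d) ⟩
    level d (bit (toℕ i) (toℕ d))  ∎
    where
    y : Word s
    y = tabulate λ d → bit (toℕ i) (toℕ d)

lemma5p7 : (G : Graph) → IsSimple G → (s : ℕ) (U : Subset (n G)) (C : Fin (n (Q s)) → Fun U) →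
    IsMinimalGenerator (Q s) G U C →
    Σ (Fin s → Fin (n G)) λ v →
      ((i j : Fin s) → v i ≡ v j → i ≡ j) ×
      ((w : Fin (n G)) → (w ∈ U → Σ (Fin s) λ j → v j ≡ w) × ((Σ (Fin s) λ j → v j ≡ w) → w ∈ U)) ×
      Σ (Fin s → Fin 2 → ℕ) λ k →
        ((j : Fin s) → (1 ≤ k j zero) × (k j zero < k j (suc zero))) ×
        ((a : Fin (n (Q s))) → Σ (Fin (2 ^ s)) λ i →
            (j : Fin s) (p : v j ∈ U) → C a (v j) p ≡ k j (bit (toℕ i) (toℕ j))) ×
        ((i : Fin (2 ^ s)) → Σ (Fin (n (Q s))) λ a →
            (j : Fin s) (p : v j ∈ U) → C a (v j) p ≡ k j (bit (toℕ i) (toℕ j)))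
lemma5p7 G _ s U C M =
  axis , (λ _ _ → axis-injective) ,
  (λ w → axes-cover w , λ { (d , refl) → axis∈U d }) ,
  level , (λ d → level-positive d zero , level-ascending d) ,
  C-index , index-C
  where open MinimalCubeGenerator {s = s} M
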